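{- Fix a choice of sign and let $m=(-2\pm i)^k$ with $k\in\mathbb{N}$, $k\geq1$. Then there exists a Gaussian integer $a$ with $\gcd(a,m)=1$ and $a/m\in\mathfrak{F}$ such that $K_{\mathbb{C}}(a/m)\leq 3\sqrt{2}$.
   Context: $\mathfrak{F}=\{z\in\mathbb{C}: -\tfrac12\leq\mathrm{Re}(z)<\tfrac12,\ -\tfrac12\leq\mathrm{Im}(z)<\tfrac12\}$. For $z\in\mathbb{C}$, $[z]:=\lfloor \mathrm{Re}(z)+\tfrac12\rfloor+i\lfloor \mathrm{Im}(z)+\tfrac12\rfloor$. The complex Gauss map $T:\mathfrak{F}\to\mathfrak{F}$ is $T(z)=z^{ -1}-[z^{ -1}]$ for $z\neq0$, $T(0)=0$. For $z\in\mathfrak{F}\setminus\{0\}$, $a_1(z)=[z^{ -1}]$ and, while $T^{n-1}(z)\neq0$, $a_n(z)=a_1(T^{n-1}(z))$; for $z\in\mathbb{Q}(i)\cap\mathfrak{F}$ this process terminates, giving the Hurwitz continued fraction $z=[a_1(z),\ldots,a_n(z)]_{\mathbb{C}}$. Define $K_{\mathbb{C}}(z)=\max(|a_1(z)|,\ldots,|a_n(z)|)$. -}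

module Defs where

open import Data.Nat using (ℕ; zero; suc)
open import Data.Integer using (ℤ; +_; -_; _+_; _-_; _*_; _≤_; _<_)
open import Data.Bool using (Bool; true; false)
open import Data.List using (List; []; _∷_)
open import Data.Product using (_×_; _,_; ∃)
open import Relation.Binary.PropositionalEquality using (_≡_)
open import Relation.Nullary using (¬_)

record ℤ[i] : Set where
  constructor _+_i
  field
    re : ℤ
    im : ℤ
open ℤ[i] public

0ᵍ 1ᵍ : ℤ[i]
0ᵍ = (+ 0) + (+ 0) i
1ᵍ = (+ 1) + (+ 0) i

_+ᵍ_ _-ᵍ_ _*ᵍ_ : ℤ[i] → ℤ[i] → ℤ[i]
(a + b i) +ᵍ (c + d i) = (a + c) + (b + d) i
(a + b i) -ᵍ (c + d i) = (a - c) + (b - d) i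
(a + b i) *ᵍ (c + d i) = (a * c - b * d) + (a * d + b * c) i

conj : ℤ[i] → ℤ[i]
conj (a + b i) = a + (- b) i

norm : ℤ[i] → ℤ
norm (a + b i) = a * a + b * b

_^ᵍ_ : ℤ[i] → ℕ → ℤ[i]
z ^ᵍ zero = 1ᵍ
z ^ᵍ suc k = z *ᵍ (z ^ᵍ k)

_∣ᵍ_ : ℤ[i] → ℤ[i] → Set
d ∣ᵍ a = ∃ λ c → a ≡ d *ᵍ c

-- Units of ℤ[i] (±1, ±i) are exactly the elements of norm 1.
IsUnit : ℤ[i] → Set
IsUnit u = ∃ λ v → u *ᵍ v ≡ 1ᵍ

Coprimeᵍ : ℤ[i] → ℤ[i] → Set
Coprimeᵍ a m = ∀ d → d ∣ᵍ a → d ∣ᵍ m → IsUnit d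

-- m ≠ 0.  The Gaussian rational a/m ∈ 𝔉, i.e.
-- -1/2 ≤ Re(a/m) < 1/2 and -1/2 ≤ Im(a/m) < 1/2, where
-- a/m = a·conj(m) / N(m); cleared of the positive denominator N(m).
InF : ℤ[i] → ℤ[i] → Set
InF a m =
  (- norm m ≤ (+ 2) * re (a *ᵍ conj m)) × ((+ 2) * re (a *ᵍ conj m) < norm m) ×
  (- norm m ≤ (+ 2) * im (a *ᵍ conj m)) × ((+ 2) * im (a *ᵍ conj m) < norm m)

-- IsFloorHalf x N n  :  n = ⌊ x/N + 1/2 ⌋   (for N > 0),
-- i.e. n ≤ x/N + 1/2 < n + 1, cleared of denominators.
IsFloorHalf : ℤ → ℤ → ℤ → Set
IsFloorHalf x N n = ((+ 2) * N * n ≤ (+ 2) * x + N) × ((+ 2) * x + N < (+ 2) * N * (n + (+ 1)))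

-- IsRound q p a  :  a = [q/p]  (p ≠ 0), with
-- [w] = ⌊Re w + 1/2⌋ + i ⌊Im w + 1/2⌋ and q/p = q·conj(p)/N(p).
IsRound : ℤ[i] → ℤ[i] → ℤ[i] → Set
IsRound q p a =
  IsFloorHalf (re (q *ᵍ conj p)) (norm p) (re a) ×
  IsFloorHalf (im (q *ᵍ conj p)) (norm p) (im a)

-- HCF p q ds : the Hurwitz continued fraction digits of z = p/q (q ≠ 0)
-- are ds = [a₁(z), …, aₙ(z)].  Otherwise a₁ = [z⁻¹] = [q/p] and
-- T(z) = q/p - a₁ = (q - a₁p)/p, whose digits are the remaining ones.
data HCF : ℤ[i] → ℤ[i] → List ℤ[i] → Set where
  hcf-stop : ∀ {q} → HCF 0ᵍ q []
  hcf-step : ∀ {p q a ds} → ¬ (p ≡ 0ᵍ) → IsRound q p a →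
             HCF (q -ᵍ (a *ᵍ p)) p ds → HCF p q (a ∷ ds)

-- All digits have norm ≤ 18, i.e. |aⱼ| ≤ 3√2, i.e. K_ℂ ≤ 3√2.
data AllNormLe18 : List ℤ[i] → Set where
  [] : AllNormLe18 []
  _∷_ : ∀ {d ds} → norm d ≤ + 18 → AllNormLe18 ds → AllNormLe18 (d ∷ ds)

base : Bool → ℤ[i]
base true  = (- (+ 2)) + (+ 1) i
base false = (- (+ 2)) + (- (+ 1)) i

-- A digit sequence is the Hurwitz expansion of its continued fraction as soon as every tail
-- value lies in the interior of 𝔉. Call a sequence admissible if each digit b either keeps
-- 1/(b + z) in the interior for every z in the closure of 𝔉 ("free"), or does so for |z| ≤ 2/5
-- ("guarded") and is followed by a digit with a coordinate of absolute value at least 3, which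
-- forces |z| ≤ 2/5. Numerator and denominator of a continued fraction are coprime because the
-- product of the partial-quotient matrices [[a, 1], [1, 0]] has determinant ±1.
--
-- Admissible sequences with denominator associated to ρᵏ, ρ = -2 + i, come from folding: the
-- word w x w̃, with w̃ the reversed negation of w, has denominator ±x·den(w)². Framing w by -ε … ε,
-- the middle digit x = ρ takes ρᵏ to ρ²ᵏ⁺¹, and the pair g₁ g₂, whose matrix is -i times that of
-- ε i -ε, takes ρᵏ to ρ²ᵏ. Explicit words for 6 ≤ k ≤ 13 start the recursion, explicit expansions
-- cover k ≤ 5, and complex conjugation turns every witness for -2 + i into one for -2 - i.

module Submission where

open import Defs
open import Data.Nat using (ℕ; _≥_)
open import Data.Bool using (Bool)
open import Data.List using (List)
open import Data.Product using (Σ; _×_)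

open import Data.Bool using (true; false)
open import Data.Integer as ℤ using (ℤ; +_; -_; -[1+_]; _+_; _-_; _*_; _≤_; _<_; ∣_∣; 0ℤ; +≤+; +<+)
import Data.Integer.Properties as ℤP
open import Data.Integer.Tactic.RingSolver using (solve-∀)
open import Data.List using ([]; _∷_; _++_; map; reverse; length)
open import Data.List.Properties using (map-++; reverse-++; reverse-map; reverse-involutive; map-∘; map-cong; map-id; ++-assoc)
open import Data.Maybe using (Maybe; just; nothing; from-just)
open import Data.Nat as ℕ using (zero; suc)
open import Data.Nat.Induction using (<-rec)
import Data.Nat.Properties as ℕP
open import Data.Nat.Tactic.RingSolver using () renaming (solve-∀ to ℕ-solve-∀)
open import Data.Product using (_,_; ∃; proj₁; proj₂)
open import Data.Sum using (_⊎_; inj₁; inj₂)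
open import Data.Unit using (⊤)
open import Function using (id)
open import Level using (0ℓ)
open import Relation.Binary.PropositionalEquality
open import Algebra.Structures {A = ℤ[i]} _≡_ using (IsCommutativeSemiring)
open import Algebra.Structures.Biased {A = ℤ[i]} _≡_ using (isCommutativeSemiringˡ; isCommutativeMonoidˡ)
open import Relation.Nullary using (¬_; Dec; yes; no; contradiction)
import Relation.Nullary.Decidable as Dec
open import Relation.Nullary.Decidable using (_×-dec_; _⊎-dec_; from-yes)
import Tactic.RingSolver as RingSolver
open import Tactic.RingSolver.Core.AlmostCommutativeRing using (AlmostCommutativeRing)

negᵍ : ℤ[i] → ℤ[i]
negᵍ (a + b i) = (- a) + (- b) i

ι : ℤ[i]
ι = (+ 0) + (+ 1) i

+ᵍ-assoc : ∀ x y z → (x +ᵍ y) +ᵍ z ≡ x +ᵍ (y +ᵍ z)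
+ᵍ-assoc (a + b i) (c + d i) (e + f i) = cong₂ _+_i (ℤP.+-assoc a c e) (ℤP.+-assoc b d f)

+ᵍ-comm : ∀ x y → x +ᵍ y ≡ y +ᵍ x
+ᵍ-comm (a + b i) (c + d i) = cong₂ _+_i (ℤP.+-comm a c) (ℤP.+-comm b d)

+ᵍ-identityˡ : ∀ x → 0ᵍ +ᵍ x ≡ x
+ᵍ-identityˡ (a + b i) = cong₂ _+_i (ℤP.+-identityˡ a) (ℤP.+-identityˡ b)

negᵍ-distrib-+ᵍ : ∀ x y → negᵍ x +ᵍ negᵍ y ≡ negᵍ (x +ᵍ y)
negᵍ-distrib-+ᵍ (a + b i) (c + d i) = cong₂ _+_i (sym (ℤP.neg-distrib-+ a c)) (sym (ℤP.neg-distrib-+ b d))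

*ᵍ-assoc : ∀ x y z → (x *ᵍ y) *ᵍ z ≡ x *ᵍ (y *ᵍ z)
*ᵍ-assoc (a + b i) (c + d i) (e + f i) = cong₂ _+_i (re-assoc a b c d e f) (im-assoc a b c d e f)
  where
  re-assoc : ∀ a b c d e f →
    (a * c - b * d) * e - (a * d + b * c) * f ≡ a * (c * e - d * f) - b * (c * f + d * e)
  re-assoc = solve-∀
  im-assoc : ∀ a b c d e f →
    (a * c - b * d) * f + (a * d + b * c) * e ≡ a * (c * f + d * e) + b * (c * e - d * f)
  im-assoc = solve-∀

*ᵍ-comm : ∀ x y → x *ᵍ y ≡ y *ᵍ x
*ᵍ-comm (a + b i) (c + d i) = cong₂ _+_i (re-comm a b c d) (im-comm a b c d)
  where
  re-comm : ∀ a b c d → a * c - b * d ≡ c * a - d * b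
  re-comm = solve-∀
  im-comm : ∀ a b c d → a * d + b * c ≡ c * b + d * a
  im-comm = solve-∀

*ᵍ-identityˡ : ∀ x → 1ᵍ *ᵍ x ≡ x
*ᵍ-identityˡ (a + b i) = cong₂ _+_i (re-identity a b) (im-identity a b)
  where
  re-identity : ∀ a b → + 1 * a - + 0 * b ≡ a
  re-identity = solve-∀
  im-identity : ∀ a b → + 1 * b + + 0 * a ≡ b
  im-identity = solve-∀

*ᵍ-zeroˡ : ∀ x → 0ᵍ *ᵍ x ≡ 0ᵍ
*ᵍ-zeroˡ (a + b i) = cong₂ _+_i (re-zero a b) (im-zero a b)
  where
  re-zero : ∀ a b → + 0 * a - + 0 * b ≡ + 0
  re-zero = solve-∀
  im-zero : ∀ a b → + 0 * b + + 0 * a ≡ + 0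
  im-zero = solve-∀

*ᵍ-distribʳ-+ᵍ : ∀ x y z → (y +ᵍ z) *ᵍ x ≡ (y *ᵍ x) +ᵍ (z *ᵍ x)
*ᵍ-distribʳ-+ᵍ (e + f i) (a + b i) (c + d i) = cong₂ _+_i (re-distrib a b c d e f) (im-distrib a b c d e f)
  where
  re-distrib : ∀ a b c d e f → (a + c) * e - (b + d) * f ≡ (a * e - b * f) + (c * e - d * f)
  re-distrib = solve-∀
  im-distrib : ∀ a b c d e f → (a + c) * f + (b + d) * e ≡ (a * f + b * e) + (c * f + d * e)
  im-distrib = solve-∀

negᵍ-distribˡ-*ᵍ : ∀ x y → negᵍ x *ᵍ y ≡ negᵍ (x *ᵍ y)
negᵍ-distribˡ-*ᵍ (a + b i) (c + d i) = cong₂ _+_i (re-neg a b c d) (im-neg a b c d)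
  where
  re-neg : ∀ a b c d → (- a) * c - (- b) * d ≡ - (a * c - b * d)
  re-neg = solve-∀
  im-neg : ∀ a b c d → (- a) * d + (- b) * c ≡ - (a * d + b * c)
  im-neg = solve-∀

ℤ[i]-isCommutativeSemiring : IsCommutativeSemiring _+ᵍ_ _*ᵍ_ 0ᵍ 1ᵍ
ℤ[i]-isCommutativeSemiring = isCommutativeSemiringˡ record
  { +-isCommutativeMonoid = isCommutativeMonoidˡ record
    { isSemigroup = record { isMagma = isMagma _+ᵍ_ ; assoc = +ᵍ-assoc }
    ; identityˡ = +ᵍ-identityˡ ; comm = +ᵍ-comm }
  ; *-isCommutativeMonoid = isCommutativeMonoidˡ record
    { isSemigroup = record { isMagma = isMagma _*ᵍ_ ; assoc = *ᵍ-assoc }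
    ; identityˡ = *ᵍ-identityˡ ; comm = *ᵍ-comm }
  ; distribʳ = *ᵍ-distribʳ-+ᵍ
  ; zeroˡ = *ᵍ-zeroˡ
  }

0ᵍ≟_ : ∀ x → Maybe (0ᵍ ≡ x)
0ᵍ≟ ((+ 0) + (+ 0) i) = just refl
0ᵍ≟ _ = nothing

ℤ[i]-ring : AlmostCommutativeRing 0ℓ 0ℓ
ℤ[i]-ring = record
  { Carrier = ℤ[i] ; _≈_ = _≡_ ; _+_ = _+ᵍ_ ; _*_ = _*ᵍ_ ; -_ = negᵍ ; 0# = 0ᵍ ; 1# = 1ᵍ
  ; 0≟_ = 0ᵍ≟_
  ; isAlmostCommutativeRing = record
    { isCommutativeSemiring = ℤ[i]-isCommutativeSemiring
    ; -‿cong = cong negᵍ ; -‿*-distribˡ = negᵍ-distribˡ-*ᵍ ; -‿+-comm = negᵍ-distrib-+ᵍ }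
  }

*ᵍ-zeroʳ : ∀ x → x *ᵍ 0ᵍ ≡ 0ᵍ
*ᵍ-zeroʳ x = trans (*ᵍ-comm x 0ᵍ) (*ᵍ-zeroˡ x)

+ᵍ-negᵍ-cancelˡ : ∀ x y → (x +ᵍ y) +ᵍ negᵍ x ≡ y
+ᵍ-negᵍ-cancelˡ = RingSolver.solve-∀ ℤ[i]-ring

negᵍ-involutive : ∀ x → negᵍ (negᵍ x) ≡ x
negᵍ-involutive (a + b i) = cong₂ _+_i (ℤP.neg-involutive a) (ℤP.neg-involutive b)

0≤i*i : ∀ a → 0ℤ ≤ a * a
0≤i*i (+ n) = subst (0ℤ ≤_) (ℤP.pos-* n n) (+≤+ ℕ.z≤n)
0≤i*i -[1+ n ] = +≤+ ℕ.z≤n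

0≤i*j : ∀ {a b} → 0ℤ ≤ a → 0ℤ ≤ b → 0ℤ ≤ a * b
0≤i*j {+ m} {+ n} _ _ = subst (0ℤ ≤_) (ℤP.pos-* m n) (+≤+ ℕ.z≤n)

0<i*j : ∀ {a b} → 0ℤ < a → 0ℤ < b → 0ℤ < a * b
0<i*j {+ suc m} {+ suc n} _ _ = +<+ (ℕ.s≤s ℕ.z≤n)
0<i*j {+ zero} (+<+ ())
0<i*j {+ suc m} {+ zero} _ (+<+ ())

0≤i+j : ∀ {a b} → 0ℤ ≤ a → 0ℤ ≤ b → 0ℤ ≤ a + b
0≤i+j = ℤP.+-mono-≤

0<i+j : ∀ {a b} → 0ℤ < a → 0ℤ ≤ b → 0ℤ < a + b
0<i+j = ℤP.+-mono-<-≤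

<⇒0<j-i : ∀ {a b} → a < b → 0ℤ < b - a
<⇒0<j-i {a} {b} h = subst (_< b - a) (ℤP.+-inverseʳ a) (ℤP.+-monoˡ-< (- a) h)

0<j-i⇒< : ∀ {a b} → 0ℤ < b - a → a < b
0<j-i⇒< {a} {b} h = subst₂ _<_ (ℤP.+-identityˡ a) (j-i+i≡j a b) (ℤP.+-monoˡ-< a h)
  where
  j-i+i≡j : ∀ a b → (b - a) + a ≡ b
  j-i+i≡j = solve-∀

-i<i⇒0<i : ∀ {x} → - x < x → 0ℤ < x
-i<i⇒0<i {+ suc n} _ = +<+ (ℕ.s≤s ℕ.z≤n)
-i<i⇒0<i {+ zero} (+<+ ())
-i<i⇒0<i { -[1+ n ]} ()

c<a+t+c⇒-a<t : ∀ {a t c} → c < a + t + c → - a < t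
c<a+t+c⇒-a<t {a} {t} {c} h = 0<j-i⇒< (subst (0ℤ <_) (cancel a t c) (<⇒0<j-i h))
  where
  cancel : ∀ a t c → a + t + c - c ≡ t - (- a)
  cancel = solve-∀

c<a-t+c⇒t<a : ∀ {a t c} → c < a - t + c → t < a
c<a-t+c⇒t<a {a} {t} {c} h = 0<j-i⇒< (subst (0ℤ <_) (cancel a t c) (<⇒0<j-i h))
  where
  cancel : ∀ a t c → a - t + c - c ≡ a - t
  cancel = solve-∀

0≤β*X+∣β∣*N : ∀ β {X N} → - N ≤ X → X ≤ N → 0ℤ ≤ β * X + + ∣ β ∣ * N
0≤β*X+∣β∣*N (+ n) {X} {N} -N≤X _ =
  subst (0ℤ ≤_) (nonneg (+ n) X N) (0≤i*j {+ n} (+≤+ ℕ.z≤n) (ℤP.i≤j⇒0≤j-i -N≤X))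
  where
  nonneg : ∀ k X N → k * (X - (- N)) ≡ k * X + k * N
  nonneg = solve-∀
0≤β*X+∣β∣*N -[1+ n ] {X} {N} _ X≤N =
  subst (0ℤ ≤_) (neg (+ suc n) X N) (0≤i*j {+ suc n} (+≤+ ℕ.z≤n) (ℤP.i≤j⇒0≤j-i X≤N))
  where
  neg : ∀ k X N → k * (N - X) ≡ (- k) * X + k * N
  neg = solve-∀

square-mono-≤ : ∀ {a b} → 0ℤ ≤ a → a ≤ b → a * a ≤ b * b
square-mono-≤ {a} {b} 0≤a a≤b =
  ℤP.0≤i-j⇒j≤i (subst (0ℤ ≤_) (difference a b) (0≤i*j (ℤP.i≤j⇒0≤j-i a≤b) (0≤i+j (ℤP.≤-trans 0≤a a≤b) 0≤a)))
  where
  difference : ∀ a b → (b - a) * (b + a) ≡ b * b - a * a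
  difference = solve-∀

t*t<u*u⇒0<u+t : ∀ u t → 0ℤ ≤ u → t * t < u * u → 0ℤ < u + t
t*t<u*u⇒0<u+t u t 0≤u t²<u² with 0ℤ ℤ.<? u + t
... | yes 0<u+t = 0<u+t
... | no 0≮u+t = contradiction t²<u² (ℤP.≤⇒≯ (subst (u * u ≤_) (neg-square t) (square-mono-≤ 0≤u u≤-t)))
  where
  u≤-t : u ≤ - t
  u≤-t = ℤP.0≤i-j⇒j≤i (subst (0ℤ ≤_) (rearrange u t) (ℤP.i≤j⇒0≤j-i (ℤP.≮⇒≥ 0≮u+t)))
    where
    rearrange : ∀ u t → 0ℤ - (u + t) ≡ (- t) - u
    rearrange = solve-∀
  neg-square : ∀ t → (- t) * (- t) ≡ t * t
  neg-square = solve-∀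

conj-+ᵍ : ∀ x y → conj (x +ᵍ y) ≡ conj x +ᵍ conj y
conj-+ᵍ (a + b i) (c + d i) = cong ((a + c) +_i) (ℤP.neg-distrib-+ b d)

conj-*ᵍ : ∀ x y → conj (x *ᵍ y) ≡ conj x *ᵍ conj y
conj-*ᵍ (a + b i) (c + d i) = cong₂ _+_i (re-conj a b c d) (im-conj a b c d)
  where
  re-conj : ∀ a b c d → a * c - b * d ≡ a * c - (- b) * (- d)
  re-conj = solve-∀
  im-conj : ∀ a b c d → - (a * d + b * c) ≡ a * (- d) + (- b) * c
  im-conj = solve-∀

conj-^ᵍ : ∀ x k → conj (x ^ᵍ k) ≡ conj x ^ᵍ k
conj-^ᵍ x zero = refl
conj-^ᵍ x (suc k) = trans (conj-*ᵍ x (x ^ᵍ k)) (cong (conj x *ᵍ_) (conj-^ᵍ x k))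

norm-*ᵍ : ∀ x y → norm (x *ᵍ y) ≡ norm x * norm y
norm-*ᵍ (a + b i) (c + d i) = lagrange a b c d
  where
  lagrange : ∀ a b c d →
    (a * c - b * d) * (a * c - b * d) + (a * d + b * c) * (a * d + b * c) ≡ (a * a + b * b) * (c * c + d * d)
  lagrange = solve-∀

norm-conj : ∀ x → norm (conj x) ≡ norm x
norm-conj (a + b i) = neg-invariant a b
  where
  neg-invariant : ∀ a b → a * a + (- b) * (- b) ≡ a * a + b * b
  neg-invariant = solve-∀

0≤norm : ∀ x → 0ℤ ≤ norm x
0≤norm (a + b i) = 0≤i+j (0≤i*i a) (0≤i*i b)

*ᵍ-conj : ∀ x → x *ᵍ conj x ≡ norm x + (+ 0) i
*ᵍ-conj (a + b i) = cong₂ _+_i (re-conj a b) (im-conj a b)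
  where
  re-conj : ∀ a b → a * a - b * (- b) ≡ a * a + b * b
  re-conj = solve-∀
  im-conj : ∀ a b → a * (- b) + b * a ≡ + 0
  im-conj = solve-∀

norm-pos⇒≢0ᵍ : ∀ {x} → 0ℤ < norm x → ¬ x ≡ 0ᵍ
norm-pos⇒≢0ᵍ 0<N refl = ℤP.<-irrefl refl 0<N

record Unit (u : ℤ[i]) : Set where
  constructor unit
  field norm≡1 : norm u ≡ + 1

Unit-*ᵍ : ∀ {u v} → Unit u → Unit v → Unit (u *ᵍ v)
Unit-*ᵍ {u} {v} (unit hu) (unit hv) = unit (trans (norm-*ᵍ u v) (cong₂ _*_ hu hv))

Unit-^ᵍ : ∀ {u} k → Unit u → Unit (u ^ᵍ k)
Unit-^ᵍ zero _ = unit refl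
Unit-^ᵍ (suc k) hu = Unit-*ᵍ hu (Unit-^ᵍ k hu)

Unit-conj : ∀ {u} → Unit u → Unit (conj u)
Unit-conj {u} (unit hu) = unit (trans (norm-conj u) hu)

Unit⇒*ᵍ-conj : ∀ {u} → Unit u → u *ᵍ conj u ≡ 1ᵍ
Unit⇒*ᵍ-conj {u} (unit hu) = trans (*ᵍ-conj u) (cong (_+ (+ 0) i) hu)

Unit⇒conj-cancel : ∀ {u} → Unit u → ∀ x → conj u *ᵍ (u *ᵍ x) ≡ x
Unit⇒conj-cancel {u} hu x = begin
  conj u *ᵍ (u *ᵍ x)   ≡⟨ *ᵍ-assoc (conj u) u x ⟨
  (conj u *ᵍ u) *ᵍ x   ≡⟨ cong (_*ᵍ x) (*ᵍ-comm (conj u) u) ⟩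
  (u *ᵍ conj u) *ᵍ x   ≡⟨ cong (_*ᵍ x) (Unit⇒*ᵍ-conj hu) ⟩
  1ᵍ *ᵍ x              ≡⟨ *ᵍ-identityˡ x ⟩
  x                    ∎
  where open ≡-Reasoning

Unit⇒cancel-conj : ∀ {u} → Unit u → ∀ x → u *ᵍ (conj u *ᵍ x) ≡ x
Unit⇒cancel-conj {u} hu x = begin
  u *ᵍ (conj u *ᵍ x)   ≡⟨ *ᵍ-assoc u (conj u) x ⟨
  (u *ᵍ conj u) *ᵍ x   ≡⟨ cong (_*ᵍ x) (Unit⇒*ᵍ-conj hu) ⟩
  1ᵍ *ᵍ x              ≡⟨ *ᵍ-identityˡ x ⟩
  x                    ∎
  where open ≡-Reasoning

norm-unit-*ᵍ : ∀ {v} → Unit v → ∀ x → norm (v *ᵍ x) ≡ norm x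
norm-unit-*ᵍ {v} (unit hv) x = trans (norm-*ᵍ v x) (trans (cong (_* norm x) hv) (ℤP.*-identityˡ (norm x)))

ratio-unit-*ᵍ : ∀ {v} → Unit v → ∀ x y → (v *ᵍ x) *ᵍ conj (v *ᵍ y) ≡ x *ᵍ conj y
ratio-unit-*ᵍ {v} hv x y = begin
  (v *ᵍ x) *ᵍ conj (v *ᵍ y)              ≡⟨ cong ((v *ᵍ x) *ᵍ_) (conj-*ᵍ v y) ⟩
  (v *ᵍ x) *ᵍ (conj v *ᵍ conj y)         ≡⟨ regroup v x (conj v) (conj y) ⟩
  (v *ᵍ conj v) *ᵍ (x *ᵍ conj y)         ≡⟨ cong (_*ᵍ (x *ᵍ conj y)) (Unit⇒*ᵍ-conj hv) ⟩
  1ᵍ *ᵍ (x *ᵍ conj y)                    ≡⟨ *ᵍ-identityˡ (x *ᵍ conj y) ⟩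
  x *ᵍ conj y                            ∎
  where
  open ≡-Reasoning
  regroup : ∀ v x w z → (v *ᵍ x) *ᵍ (w *ᵍ z) ≡ (v *ᵍ w) *ᵍ (x *ᵍ z)
  regroup = RingSolver.solve-∀ ℤ[i]-ring

Associated : ℤ[i] → ℤ[i] → Set
Associated x y = Σ ℤ[i] λ u → Unit u × x ≡ u *ᵍ y

-- The fundamental domain 𝔉

-- N(q)·2Re(p/q) and N(q)·2Im(p/q)
twoRe twoIm : ℤ[i] → ℤ[i] → ℤ
twoRe p q = + 2 * re (p *ᵍ conj q)
twoIm p q = + 2 * im (p *ᵍ conj q)

record Square (_≺_ : ℤ → ℤ → Set) (p q : ℤ[i]) : Set where
  constructor square
  field
    norm-pos : 0ℤ < norm q
    re-lower : (- norm q) ≺ twoRe p q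
    re-upper : twoRe p q ≺ norm q
    im-lower : (- norm q) ≺ twoIm p q
    im-upper : twoIm p q ≺ norm q

-- p/q in the closure, resp. the interior, of 𝔉
Closed𝔉 Open𝔉 : ℤ[i] → ℤ[i] → Set
Closed𝔉 = Square _≤_
Open𝔉 = Square _<_

Open⇒Closed : ∀ {p q} → Open𝔉 p q → Closed𝔉 p q
Open⇒Closed (square n a b c d) = square n (ℤP.<⇒≤ a) (ℤP.<⇒≤ b) (ℤP.<⇒≤ c) (ℤP.<⇒≤ d)

Open⇒InF : ∀ {p q} → Open𝔉 p q → InF p q
Open⇒InF (square _ a b c d) = ℤP.<⇒≤ a , b , ℤP.<⇒≤ c , d

Open𝔉-0/1 : Open𝔉 0ᵍ 1ᵍ
Open𝔉-0/1 = square (+<+ (ℕ.s≤s ℕ.z≤n)) ℤ.-<+ (+<+ (ℕ.s≤s ℕ.z≤n)) ℤ.-<+ (+<+ (ℕ.s≤s ℕ.z≤n))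

Within⅖ : ℤ[i] → ℤ[i] → Set
Within⅖ p q = + 25 * norm p ≤ + 4 * norm q

record AllShifts (P : ℤ[i] → Set) (b : ℤ[i]) : Set where
  constructor shifts
  field
    at+1 : P (b +ᵍ 1ᵍ)
    at-1 : P (b +ᵍ negᵍ 1ᵍ)
    at+i : P (b +ᵍ ι)
    at-i : P (b +ᵍ negᵍ ι)

mapShifts : ∀ {P Q : ℤ[i] → Set} → (∀ {d} → P d → Q d) → ∀ {b} → AllShifts P b → AllShifts Q b
mapShifts f (shifts p₁ p₂ p₃ p₄) = shifts (f p₁) (f p₂) (f p₃) (f p₄)

-- q/y lies in the interior of 𝔉 as soon as y/q avoids the closed unit discs around ±1 and ±i.
Open𝔉-reciprocal : ∀ {b p q} → AllShifts (λ d → norm q < norm ((d *ᵍ q) +ᵍ p)) b →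
                   Open𝔉 q ((b *ᵍ q) +ᵍ p)
Open𝔉-reciprocal {b} {p} {q} (shifts far₁ far₋₁ farᵢ far₋ᵢ) =
  square (-i<i⇒0<i (ℤP.<-trans re-lower re-upper)) re-lower re-upper im-lower im-upper
  where
  y = (b *ᵍ q) +ᵍ p

  shift : ∀ b δ q p → ((b +ᵍ δ) *ᵍ q) +ᵍ p ≡ ((b *ᵍ q) +ᵍ p) +ᵍ (δ *ᵍ q)
  shift = RingSolver.solve-∀ ℤ[i]-ring

  expand₁ : ∀ yr yi qr qi →
    (yr + (+ 1 * qr - + 0 * qi)) * (yr + (+ 1 * qr - + 0 * qi)) + (yi + (+ 1 * qi + + 0 * qr)) * (yi + (+ 1 * qi + + 0 * qr))
    ≡ (yr * yr + yi * yi) + + 2 * (qr * yr - qi * - yi) + (qr * qr + qi * qi)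
  expand₁ = solve-∀
  expand₋₁ : ∀ yr yi qr qi →
    (yr + (- + 1 * qr - - + 0 * qi)) * (yr + (- + 1 * qr - - + 0 * qi)) + (yi + (- + 1 * qi + - + 0 * qr)) * (yi + (- + 1 * qi + - + 0 * qr))
    ≡ (yr * yr + yi * yi) - + 2 * (qr * yr - qi * - yi) + (qr * qr + qi * qi)
  expand₋₁ = solve-∀
  expandᵢ : ∀ yr yi qr qi →
    (yr + (+ 0 * qr - + 1 * qi)) * (yr + (+ 0 * qr - + 1 * qi)) + (yi + (+ 0 * qi + + 1 * qr)) * (yi + (+ 0 * qi + + 1 * qr))
    ≡ (yr * yr + yi * yi) - + 2 * (qr * - yi + qi * yr) + (qr * qr + qi * qi)
  expandᵢ = solve-∀
  expand₋ᵢ : ∀ yr yi qr qi →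
    (yr + (- + 0 * qr - - + 1 * qi)) * (yr + (- + 0 * qr - - + 1 * qi)) + (yi + (- + 0 * qi + - + 1 * qr)) * (yi + (- + 0 * qi + - + 1 * qr))
    ≡ (yr * yr + yi * yi) + + 2 * (qr * - yi + qi * yr) + (qr * qr + qi * qi)
  expand₋ᵢ = solve-∀

  re-lower : - norm y < twoRe q y
  re-lower = c<a+t+c⇒-a<t (subst (norm q <_) (trans (cong norm (shift b 1ᵍ q p)) (expand₁ (re y) (im y) (re q) (im q))) far₁)
  re-upper : twoRe q y < norm y
  re-upper = c<a-t+c⇒t<a (subst (norm q <_) (trans (cong norm (shift b (negᵍ 1ᵍ) q p)) (expand₋₁ (re y) (im y) (re q) (im q))) far₋₁)
  im-upper : twoIm q y < norm y
  im-upper = c<a-t+c⇒t<a (subst (norm q <_) (trans (cong norm (shift b ι q p)) (expandᵢ (re y) (im y) (re q) (im q))) farᵢ)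
  im-lower : - norm y < twoIm q y
  im-lower = c<a+t+c⇒-a<t (subst (norm q <_) (trans (cong norm (shift b (negᵍ ι) q p)) (expand₋ᵢ (re y) (im y) (re q) (im q))) far₋ᵢ)

norm-affine : ∀ d q p → norm ((d *ᵍ q) +ᵍ p) ≡ norm d * norm q + (re d * twoRe p q + im d * twoIm p q) + norm p
norm-affine (dr + di i) (qr + qi i) (pr + pi i) = expand dr di qr qi pr pi
  where
  expand : ∀ dr di qr qi pr pi →
    (dr * qr - di * qi + pr) * (dr * qr - di * qi + pr) + (dr * qi + di * qr + pi) * (dr * qi + di * qr + pi)
    ≡ (dr * dr + di * di) * (qr * qr + qi * qi)
      + (dr * (+ 2 * (pr * qr - pi * - qi)) + di * (+ 2 * (pr * - qi + pi * qr))) + (pr * pr + pi * pi)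
  expand = solve-∀

Far : ℤ[i] → Set
Far d = + ∣ re d ∣ + + ∣ im d ∣ < norm d - + 1

far⇒outside : ∀ {d p q} → Far d → Closed𝔉 p q → norm q < norm ((d *ᵍ q) +ᵍ p)
far⇒outside {d} {p} {q} far (square 0<N X-lower X-upper Y-lower Y-upper) =
  0<j-i⇒< (subst (0ℤ <_) (trans certificate (cong (_- norm q) (sym (norm-affine d q p))))
    (0<i+j (0<i+j (0<i+j (0<i*j (<⇒0<j-i far) 0<N)
                         (0≤β*X+∣β∣*N (re d) X-lower X-upper))
                  (0≤β*X+∣β∣*N (im d) Y-lower Y-upper))
           (0≤norm p)))
  where
  rearrange : ∀ D N a b X Y S A B →
    (D - + 1 - (A + B)) * N + (a * X + A * N) + (b * Y + B * N) + S ≡ D * N + (a * X + b * Y) + S - N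
  rearrange = solve-∀
  certificate = rearrange (norm d) (norm q) (re d) (im d) (twoRe p q) (twoIm p q) (norm p) (+ ∣ re d ∣) (+ ∣ im d ∣)

cauchy-schwarz : ∀ a b X Y → (a * X + b * Y) * (a * X + b * Y) ≤ (a * a + b * b) * (X * X + Y * Y)
cauchy-schwarz a b X Y = ℤP.0≤i-j⇒j≤i (subst (0ℤ ≤_) (lagrange a b X Y) (0≤i*i (a * Y - b * X)))
  where
  lagrange : ∀ a b X Y →
    (a * Y - b * X) * (a * Y - b * X) ≡ (a * a + b * b) * (X * X + Y * Y) - (a * X + b * Y) * (a * X + b * Y)
  lagrange = solve-∀

twoRe²+twoIm² : ∀ p q → twoRe p q * twoRe p q + twoIm p q * twoIm p q ≡ + 4 * norm q * norm p
twoRe²+twoIm² (pr + pi i) (qr + qi i) = expand pr pi qr qi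
  where
  expand : ∀ pr pi qr qi →
    + 2 * (pr * qr - pi * - qi) * (+ 2 * (pr * qr - pi * - qi)) + + 2 * (pr * - qi + pi * qr) * (+ 2 * (pr * - qi + pi * qr))
    ≡ + 4 * (qr * qr + qi * qi) * (pr * pr + pi * pi)
  expand = solve-∀

guarded-gap : ∀ {D N S} → + 2 ≤ D → 0ℤ < N → 0ℤ ≤ S → + 25 * S ≤ + 4 * N →
              D * (+ 4 * N * S) < ((D - + 1) * N + S) * ((D - + 1) * N + S)
guarded-gap {D} {N} {S} 2≤D 0<N 0≤S 25S≤4N =
  0<j-i⇒< (ℤP.*-cancelˡ-<-nonNeg (+ 25) (subst (0ℤ <_) (certificate D N S) (0<i+j (0<i+j leading squared) cross)))
  where
  E = D - + 2
  0≤E : 0ℤ ≤ E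
  0≤E = ℤP.i≤j⇒0≤j-i 2≤D
  leading : 0ℤ < (+ 1 + (+ 25 * E * E + + 42 * E)) * (N * N)
  leading = 0<i*j (0<i+j {+ 1} (+<+ (ℕ.s≤s ℕ.z≤n)) (0≤i+j (0≤i*j (0≤i*j {+ 25} (+≤+ ℕ.z≤n) 0≤E) 0≤E) (0≤i*j {+ 42} (+≤+ ℕ.z≤n) 0≤E)))
                  (0<i*j 0<N 0<N)
  squared : 0ℤ ≤ + 25 * (S * S)
  squared = 0≤i*j {+ 25} (+≤+ ℕ.z≤n) (0≤i*i S)
  cross : 0ℤ ≤ + 2 * (E + + 3) * N * (+ 4 * N - + 25 * S)
  cross = 0≤i*j (0≤i*j (0≤i*j {+ 2} (+≤+ ℕ.z≤n) (0≤i+j 0≤E (+≤+ ℕ.z≤n))) (ℤP.<⇒≤ 0<N)) (ℤP.i≤j⇒0≤j-i 25S≤4N)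
  certificate : ∀ D N S →
    (+ 1 + (+ 25 * (D - + 2) * (D - + 2) + + 42 * (D - + 2))) * (N * N) + + 25 * (S * S)
      + + 2 * ((D - + 2) + + 3) * N * (+ 4 * N - + 25 * S)
    ≡ + 25 * (((D - + 1) * N + S) * ((D - + 1) * N + S) - D * (+ 4 * N * S))
  certificate = solve-∀

-- |d + p/q| ≥ √2 - 2/5 > 1, squared out with Cauchy–Schwarz.
guarded⇒outside : ∀ {d p q} → + 2 ≤ norm d → Within⅖ p q → 0ℤ < norm q → norm q < norm ((d *ᵍ q) +ᵍ p)
guarded⇒outside {d} {p} {q} 2≤D small 0<N =
  0<j-i⇒< (subst (0ℤ <_) (trans (rearrange (norm d) (norm q) (norm p) T) (cong (_- norm q) (sym (norm-affine d q p))))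
    (t*t<u*u⇒0<u+t U T 0≤U (ℤP.≤-<-trans T²≤4DNS (guarded-gap 2≤D 0<N (0≤norm p) small))))
  where
  T = re d * twoRe p q + im d * twoIm p q
  U = (norm d - + 1) * norm q + norm p
  0≤U : 0ℤ ≤ U
  0≤U = 0≤i+j (0≤i*j (ℤP.i≤j⇒0≤j-i (ℤP.≤-trans (+≤+ (ℕ.s≤s ℕ.z≤n)) 2≤D)) (ℤP.<⇒≤ 0<N)) (0≤norm p)
  T²≤4DNS : T * T ≤ norm d * (+ 4 * norm q * norm p)
  T²≤4DNS = subst (T * T ≤_) (cong (norm d *_) (twoRe²+twoIm² p q)) (cauchy-schwarz (re d) (im d) (twoRe p q) (twoIm p q))
  rearrange : ∀ D N S T → ((D - + 1) * N + S) + T ≡ D * N + T + S - N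
  rearrange = solve-∀

∣_∣≥3 : ℤ → Set
∣ x ∣≥3 = + 3 ≤ x ⊎ x ≤ - + 3

Large : ℤ[i] → Set
Large b = ∣ re b ∣≥3 ⊎ ∣ im b ∣≥3

five-bound : ∀ {β N X} → 0ℤ ≤ N → - N ≤ X → X ≤ N → ∣ β ∣≥3 →
             (+ 5 * N) * (+ 5 * N) ≤ (+ 2 * N * β + X) * (+ 2 * N * β + X)
five-bound {β} {N} {X} 0≤N X-lower _ (inj₁ 3≤β) =
  square-mono-≤ {b = + 2 * N * β + X} (0≤i*j {+ 5} (+≤+ ℕ.z≤n) 0≤N) (ℤP.0≤i-j⇒j≤i (subst (0ℤ ≤_) (rearrange β N X)
    (0≤i+j (0≤i*j (0≤i*j {+ 2} (+≤+ ℕ.z≤n) (ℤP.i≤j⇒0≤j-i 3≤β)) 0≤N) (ℤP.i≤j⇒0≤j-i X-lower))))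
  where
  rearrange : ∀ β N X → + 2 * (β - + 3) * N + (X - (- N)) ≡ (+ 2 * N * β + X) - + 5 * N
  rearrange = solve-∀
five-bound {β} {N} {X} 0≤N _ X-upper (inj₂ β≤-3) =
  subst ((+ 5 * N) * (+ 5 * N) ≤_) (neg-square (+ 2 * N * β + X))
    (square-mono-≤ {b = - (+ 2 * N * β + X)} (0≤i*j {+ 5} (+≤+ ℕ.z≤n) 0≤N) (ℤP.0≤i-j⇒j≤i (subst (0ℤ ≤_) (rearrange β N X)
      (0≤i+j (0≤i*j (0≤i*j {+ 2} (+≤+ ℕ.z≤n) (ℤP.i≤j⇒0≤j-i β≤-3)) 0≤N) (ℤP.i≤j⇒0≤j-i X-upper)))))
  where
  rearrange : ∀ β N X → + 2 * ((- + 3) - β) * N + (N - X) ≡ (- (+ 2 * N * β + X)) - + 5 * N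
  rearrange = solve-∀
  neg-square : ∀ t → (- t) * (- t) ≡ t * t
  neg-square = solve-∀

twoRe-affine : ∀ a q p → twoRe ((a *ᵍ q) +ᵍ p) q ≡ + 2 * norm q * re a + twoRe p q
twoRe-affine (ar + ai i) (qr + qi i) (pr + pi i) = expand ar ai qr qi pr pi
  where
  expand : ∀ ar ai qr qi pr pi →
    + 2 * ((ar * qr - ai * qi + pr) * qr - (ar * qi + ai * qr + pi) * - qi)
    ≡ + 2 * (qr * qr + qi * qi) * ar + + 2 * (pr * qr - pi * - qi)
  expand = solve-∀

twoIm-affine : ∀ a q p → twoIm ((a *ᵍ q) +ᵍ p) q ≡ + 2 * norm q * im a + twoIm p q
twoIm-affine (ar + ai i) (qr + qi i) (pr + pi i) = expand ar ai qr qi pr pi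
  where
  expand : ∀ ar ai qr qi pr pi →
    + 2 * ((ar * qr - ai * qi + pr) * - qi + (ar * qi + ai * qr + pi) * qr)
    ≡ + 2 * (qr * qr + qi * qi) * ai + + 2 * (pr * - qi + pi * qr)
  expand = solve-∀

-- |b + p/q| ≥ 3 - 1/2 = 5/2.
large⇒within⅖ : ∀ {b p q} → Large b → Closed𝔉 p q → Within⅖ q ((b *ᵍ q) +ᵍ p)
large⇒within⅖ {b} {p} {q} large (square 0<N X-lower X-upper Y-lower Y-upper) =
  ℤP.*-cancelˡ-≤-pos (+ 25 * N) (+ 4 * norm y) N {{ℤ.positive 0<N}}
    (subst₂ _≤_ (square-of-5N N) (sym 4N·Ny) (bound large))
  where
  N = norm q
  y = (b *ᵍ q) +ᵍ p
  u = twoRe y q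
  v = twoIm y q
  reassociate : ∀ N M → N * (+ 4 * M) ≡ + 4 * N * M
  reassociate = solve-∀
  4N·Ny : N * (+ 4 * norm y) ≡ u * u + v * v
  4N·Ny = trans (reassociate N (norm y)) (sym (twoRe²+twoIm² y q))
  bound : Large b → (+ 5 * N) * (+ 5 * N) ≤ u * u + v * v
  bound (inj₁ h) = ℤP.≤-trans
    (subst (λ t → _ ≤ t * t) (sym (twoRe-affine b q p)) (five-bound (ℤP.<⇒≤ 0<N) X-lower X-upper h))
    (ℤP.i≤i+j (u * u) (v * v) {{ℤ.nonNegative (0≤i*i v)}})
  bound (inj₂ h) = ℤP.≤-trans
    (subst (λ t → _ ≤ t * t) (sym (twoIm-affine b q p)) (five-bound (ℤP.<⇒≤ 0<N) Y-lower Y-upper h))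
    (ℤP.i≤j+i (v * v) (u * u) {{ℤ.nonNegative (0≤i*i u)}})
  square-of-5N : ∀ N → (+ 5 * N) * (+ 5 * N) ≡ N * (+ 25 * N)
  square-of-5N = solve-∀

isFloorHalf-intro : ∀ {x N n X} → (+ 2) * x ≡ (+ 2) * N * n + X → - N ≤ X → X < N → IsFloorHalf x N n
isFloorHalf-intro {x} {N} {n} {X} 2x≡ X-lower X-upper rewrite 2x≡ =
  ℤP.0≤i-j⇒j≤i (subst (0ℤ ≤_) (lower N n X) (ℤP.i≤j⇒0≤j-i X-lower)) ,
  0<j-i⇒< (subst (0ℤ <_) (upper N n X) (<⇒0<j-i X-upper))
  where
  lower : ∀ N n X → X - (- N) ≡ ((+ 2) * N * n + X + N) - (+ 2) * N * n
  lower = solve-∀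
  upper : ∀ N n X → N - X ≡ (+ 2) * N * (n + + 1) - ((+ 2) * N * n + X + N)
  upper = solve-∀

isRound-affine : ∀ a {p q} → InF p q → IsRound ((a *ᵍ q) +ᵍ p) q a
isRound-affine a {p} {q} (re-lower , re-upper , im-lower , im-upper) =
  isFloorHalf-intro (twoRe-affine a q p) re-lower re-upper ,
  isFloorHalf-intro (twoIm-affine a q p) im-lower im-upper

-- Continued fractions as matrix products

record Mat : Set where
  constructor mat
  field m₁₁ m₁₂ m₂₁ m₂₂ : ℤ[i]
open Mat

mat-cong : ∀ {a b c d a′ b′ c′ d′} → a ≡ a′ → b ≡ b′ → c ≡ c′ → d ≡ d′ → mat a b c d ≡ mat a′ b′ c′ d′
mat-cong refl refl refl refl = refl

infixl 7 _·_
_·_ : Mat → Mat → Mat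
mat a b c d · mat e f g h =
  mat ((a *ᵍ e) +ᵍ (b *ᵍ g)) ((a *ᵍ f) +ᵍ (b *ᵍ h)) ((c *ᵍ e) +ᵍ (d *ᵍ g)) ((c *ᵍ f) +ᵍ (d *ᵍ h))

I₂ : Mat
I₂ = mat 1ᵍ 0ᵍ 0ᵍ 1ᵍ

scale : ℤ[i] → Mat → Mat
scale s (mat a b c d) = mat (s *ᵍ a) (s *ᵍ b) (s *ᵍ c) (s *ᵍ d)

det : Mat → ℤ[i]
det (mat a b c d) = (a *ᵍ d) +ᵍ negᵍ (b *ᵍ c)

-- The transpose conjugated by diag(1, -1).
flip : Mat → Mat
flip (mat a b c d) = mat a (negᵍ c) (negᵍ b) d

·-identityˡ : ∀ X → I₂ · X ≡ X
·-identityˡ (mat a b c d) = mat-cong (first a c) (first b d) (second a c) (second b d)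
  where
  first : ∀ a c → (1ᵍ *ᵍ a) +ᵍ (0ᵍ *ᵍ c) ≡ a
  first = RingSolver.solve-∀ ℤ[i]-ring
  second : ∀ a c → (0ᵍ *ᵍ a) +ᵍ (1ᵍ *ᵍ c) ≡ c
  second = RingSolver.solve-∀ ℤ[i]-ring

scale-·ˡ : ∀ s X Y → scale s X · Y ≡ scale s (X · Y)
scale-·ˡ s (mat a b c d) (mat e f g h) =
  mat-cong (entry s a b e g) (entry s a b f h) (entry s c d e g) (entry s c d f h)
  where
  entry : ∀ s a b e g → ((s *ᵍ a) *ᵍ e) +ᵍ ((s *ᵍ b) *ᵍ g) ≡ s *ᵍ ((a *ᵍ e) +ᵍ (b *ᵍ g))
  entry = RingSolver.solve-∀ ℤ[i]-ring

scale-·ʳ : ∀ s X Y → X · scale s Y ≡ scale s (X · Y)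
scale-·ʳ s (mat a b c d) (mat e f g h) =
  mat-cong (entry s a b e g) (entry s a b f h) (entry s c d e g) (entry s c d f h)
  where
  entry : ∀ s a b e g → (a *ᵍ (s *ᵍ e)) +ᵍ (b *ᵍ (s *ᵍ g)) ≡ s *ᵍ ((a *ᵍ e) +ᵍ (b *ᵍ g))
  entry = RingSolver.solve-∀ ℤ[i]-ring

scale-scale : ∀ s t X → scale s (scale t X) ≡ scale (s *ᵍ t) X
scale-scale s t (mat a b c d) = mat-cong (assoc a) (assoc b) (assoc c) (assoc d)
  where
  assoc : ∀ x → s *ᵍ (t *ᵍ x) ≡ (s *ᵍ t) *ᵍ x
  assoc x = sym (*ᵍ-assoc s t x)

-- Left multiplication by the partial-quotient matrix [[a, 1], [1, 0]].
push : ℤ[i] → Mat → Mat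
push a (mat p q r s) = mat ((a *ᵍ p) +ᵍ r) ((a *ᵍ q) +ᵍ s) p q

-- num l / den l is the continued fraction [a₁, …, aₙ] = 1/(a₁ + 1/(a₂ + ⋯ + 1/aₙ)) of l.
cfMatrix : List ℤ[i] → Mat
cfMatrix [] = I₂
cfMatrix (a ∷ l) = push a (cfMatrix l)

num den : List ℤ[i] → ℤ[i]
num l = m₂₁ (cfMatrix l)
den l = m₁₁ (cfMatrix l)

push-· : ∀ a X Y → push a (X · Y) ≡ push a X · Y
push-· a (mat p q r s) (mat e f g h) =
  mat-cong (top a p q r s e g) (top a p q r s f h) refl refl
  where
  top : ∀ a p q r s e g →
    (a *ᵍ ((p *ᵍ e) +ᵍ (q *ᵍ g))) +ᵍ ((r *ᵍ e) +ᵍ (s *ᵍ g))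
    ≡ (((a *ᵍ p) +ᵍ r) *ᵍ e) +ᵍ (((a *ᵍ q) +ᵍ s) *ᵍ g)
  top = RingSolver.solve-∀ ℤ[i]-ring

cfMatrix-++ : ∀ xs ys → cfMatrix (xs ++ ys) ≡ cfMatrix xs · cfMatrix ys
cfMatrix-++ [] ys = sym (·-identityˡ (cfMatrix ys))
cfMatrix-++ (a ∷ xs) ys = trans (cong (push a) (cfMatrix-++ xs ys)) (push-· a (cfMatrix xs) (cfMatrix ys))

det-push : ∀ a X → det (push a X) ≡ negᵍ (det X)
det-push a (mat p q r s) = expand a p q r s
  where
  expand : ∀ a p q r s → (((a *ᵍ p) +ᵍ r) *ᵍ q) +ᵍ negᵍ (((a *ᵍ q) +ᵍ s) *ᵍ p) ≡ negᵍ ((p *ᵍ s) +ᵍ negᵍ (q *ᵍ r))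
  expand = RingSolver.solve-∀ ℤ[i]-ring

det²-cfMatrix : ∀ l → det (cfMatrix l) *ᵍ det (cfMatrix l) ≡ 1ᵍ
det²-cfMatrix [] = refl
det²-cfMatrix (a ∷ l) = begin
  det (push a P) *ᵍ det (push a P)   ≡⟨ cong₂ _*ᵍ_ (det-push a P) (det-push a P) ⟩
  negᵍ (det P) *ᵍ negᵍ (det P)       ≡⟨ neg-square (det P) ⟩
  det P *ᵍ det P                     ≡⟨ det²-cfMatrix l ⟩
  1ᵍ                                 ∎
  where
  open ≡-Reasoning
  P = cfMatrix l
  neg-square : ∀ x → negᵍ x *ᵍ negᵍ x ≡ x *ᵍ x
  neg-square = RingSolver.solve-∀ ℤ[i]-ring

flip-push : ∀ a X → flip (push a X) ≡ scale (negᵍ 1ᵍ) (flip X · cfMatrix (negᵍ a ∷ []))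
flip-push a (mat p q r s) = mat-cong (e₁₁ a p r) (e₁₂ a p r) (e₂₁ a q s) (e₂₂ a q s)
  where
  e₁₁ : ∀ a p r → (a *ᵍ p) +ᵍ r ≡ negᵍ 1ᵍ *ᵍ ((p *ᵍ ((negᵍ a *ᵍ 1ᵍ) +ᵍ 0ᵍ)) +ᵍ (negᵍ r *ᵍ 1ᵍ))
  e₁₁ = RingSolver.solve-∀ ℤ[i]-ring
  e₁₂ : ∀ a p r → negᵍ p ≡ negᵍ 1ᵍ *ᵍ ((p *ᵍ ((negᵍ a *ᵍ 0ᵍ) +ᵍ 1ᵍ)) +ᵍ (negᵍ r *ᵍ 0ᵍ))
  e₁₂ = RingSolver.solve-∀ ℤ[i]-ring
  e₂₁ : ∀ a q s → negᵍ ((a *ᵍ q) +ᵍ s) ≡ negᵍ 1ᵍ *ᵍ ((negᵍ q *ᵍ ((negᵍ a *ᵍ 1ᵍ) +ᵍ 0ᵍ)) +ᵍ (s *ᵍ 1ᵍ))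
  e₂₁ = RingSolver.solve-∀ ℤ[i]-ring
  e₂₂ : ∀ a q s → q ≡ negᵍ 1ᵍ *ᵍ ((negᵍ q *ᵍ ((negᵍ a *ᵍ 0ᵍ) +ᵍ 1ᵍ)) +ᵍ (s *ᵍ 0ᵍ))
  e₂₂ = RingSolver.solve-∀ ℤ[i]-ring

-- Admissible digit sequences

Free Guarded : ℤ[i] → Set
Free = AllShifts Far
Guarded = AllShifts (λ d → + 2 ≤ norm d)

LeadsLarge : List ℤ[i] → Set
LeadsLarge [] = ⊤
LeadsLarge (b ∷ _) = Large b

data Admissible : List ℤ[i] → Set where
  [] : Admissible []
  free : ∀ {b l} → Free b → norm b ≤ + 18 → Admissible l → Admissible (b ∷ l)
  guarded : ∀ {b l} → Guarded b → norm b ≤ + 18 → LeadsLarge l → Admissible l → Admissible (b ∷ l)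

Admissible-tail : ∀ {b l} → Admissible (b ∷ l) → Admissible l
Admissible-tail (free _ _ adm) = adm
Admissible-tail (guarded _ _ _ adm) = adm

admissible-value : ∀ {l} → Admissible l → Open𝔉 (num l) (den l) × (LeadsLarge l → Within⅖ (num l) (den l))
admissible-value [] = Open𝔉-0/1 , λ _ → +≤+ ℕ.z≤n
admissible-value (free fb _ adm) =
  Open𝔉-reciprocal (mapShifts (λ {d} far → far⇒outside {d} far closed) fb) , λ large → large⇒within⅖ large closed
  where
  closed = Open⇒Closed (proj₁ (admissible-value adm))
admissible-value (guarded {l = l} gb _ leadsLarge adm) =
  Open𝔉-reciprocal (mapShifts (λ {d} 2≤N → guarded⇒outside {d} {num l} {den l} 2≤N (small leadsLarge) (Square.norm-pos open𝔉)) gb) ,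
  λ large → large⇒within⅖ large (Open⇒Closed open𝔉)
  where
  open𝔉 = proj₁ (admissible-value adm)
  small = proj₂ (admissible-value adm)

admissible⇒HCF : ∀ {l} → Admissible l → HCF (num l) (den l) l
admissible⇒HCF [] = hcf-stop
admissible⇒HCF {b ∷ l} adm =
  hcf-step (norm-pos⇒≢0ᵍ (Square.norm-pos open𝔉)) (isRound-affine b (Open⇒InF open𝔉))
    (subst (λ z → HCF z (den l) l) (sym (+ᵍ-negᵍ-cancelˡ (b *ᵍ den l) (num l))) (admissible⇒HCF (Admissible-tail adm)))
  where
  open𝔉 = proj₁ (admissible-value (Admissible-tail adm))

admissible⇒bounded : ∀ {l} → Admissible l → AllNormLe18 l
admissible⇒bounded [] = []
admissible⇒bounded (free _ n≤18 adm) = n≤18 ∷ admissible⇒bounded adm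
admissible⇒bounded (guarded _ n≤18 _ adm) = n≤18 ∷ admissible⇒bounded adm

Zaremba : ℤ[i] → Set
Zaremba m = Σ ℤ[i] λ a → Coprimeᵍ a m × InF a m × Σ (List ℤ[i]) λ ds → HCF a m ds × AllNormLe18 ds

bézout⇒coprime : ∀ {a m} α β → (α *ᵍ a) +ᵍ (β *ᵍ m) ≡ 1ᵍ → Coprimeᵍ a m
bézout⇒coprime α β bézout d (c₁ , refl) (c₂ , refl) = (α *ᵍ c₁) +ᵍ (β *ᵍ c₂) , (begin
  d *ᵍ ((α *ᵍ c₁) +ᵍ (β *ᵍ c₂))           ≡⟨ regroup d α β c₁ c₂ ⟩
  (α *ᵍ (d *ᵍ c₁)) +ᵍ (β *ᵍ (d *ᵍ c₂))   ≡⟨ bézout ⟩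
  1ᵍ                                     ∎)
  where
  open ≡-Reasoning
  regroup : ∀ d α β c₁ c₂ → d *ᵍ ((α *ᵍ c₁) +ᵍ (β *ᵍ c₂)) ≡ (α *ᵍ (d *ᵍ c₁)) +ᵍ (β *ᵍ (d *ᵍ c₂))
  regroup = RingSolver.solve-∀ ℤ[i]-ring

-- det (cfMatrix l) = ±1 gives the Bézout relation.
cf-coprime : ∀ l {u a m} → u *ᵍ a ≡ num l → u *ᵍ m ≡ den l → Coprimeᵍ a m
cf-coprime l {u} {a} {m} ua≡num um≡den =
  bézout⇒coprime (Δ *ᵍ negᵍ (m₁₂ P *ᵍ u)) (Δ *ᵍ (m₂₂ P *ᵍ u)) (begin
    ((Δ *ᵍ negᵍ (m₁₂ P *ᵍ u)) *ᵍ a) +ᵍ ((Δ *ᵍ (m₂₂ P *ᵍ u)) *ᵍ m)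
      ≡⟨ regroup Δ (m₁₂ P) (m₂₂ P) u a m ⟩
    Δ *ᵍ (((u *ᵍ m) *ᵍ m₂₂ P) +ᵍ negᵍ (m₁₂ P *ᵍ (u *ᵍ a)))
      ≡⟨ cong₂ (λ x y → Δ *ᵍ ((x *ᵍ m₂₂ P) +ᵍ negᵍ (m₁₂ P *ᵍ y))) um≡den ua≡num ⟩
    Δ *ᵍ Δ
      ≡⟨ det²-cfMatrix l ⟩
    1ᵍ ∎)
  where
  open ≡-Reasoning
  P = cfMatrix l
  Δ = det P
  regroup : ∀ Δ b c u a m →
    ((Δ *ᵍ negᵍ (b *ᵍ u)) *ᵍ a) +ᵍ ((Δ *ᵍ (c *ᵍ u)) *ᵍ m) ≡ Δ *ᵍ (((u *ᵍ m) *ᵍ c) +ᵍ negᵍ (b *ᵍ (u *ᵍ a)))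
  regroup = RingSolver.solve-∀ ℤ[i]-ring

InF-unit-*ᵍ : ∀ {v p q} → Unit v → InF p q → InF (v *ᵍ p) (v *ᵍ q)
InF-unit-*ᵍ {v} {p} {q} hv =
  subst₂ (λ w N → (- N ≤ (+ 2) * re w) × ((+ 2) * re w < N) × (- N ≤ (+ 2) * im w) × ((+ 2) * im w < N))
    (sym (ratio-unit-*ᵍ hv p q)) (sym (norm-unit-*ᵍ hv q))

HCF-unit-*ᵍ : ∀ {v p q ds} → Unit v → HCF p q ds → HCF (v *ᵍ p) (v *ᵍ q) ds
HCF-unit-*ᵍ {v} hv (hcf-stop {q}) = subst (λ z → HCF z (v *ᵍ q) []) (sym (*ᵍ-zeroʳ v)) hcf-stop
HCF-unit-*ᵍ {v} hv (hcf-step {p} {q} {a} {ds} p≢0 round rest) =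
  hcf-step vp≢0
    (subst₂ (λ w N → IsFloorHalf (re w) N (re a) × IsFloorHalf (im w) N (im a))
      (sym (ratio-unit-*ᵍ hv q p)) (sym (norm-unit-*ᵍ hv p)) round)
    (subst (λ z → HCF z (v *ᵍ p) ds) (distrib v q a p) (HCF-unit-*ᵍ hv rest))
  where
  vp≢0 : ¬ v *ᵍ p ≡ 0ᵍ
  vp≢0 vp≡0 = p≢0 (trans (sym (Unit⇒conj-cancel hv p)) (trans (cong (conj v *ᵍ_) vp≡0) (*ᵍ-zeroʳ (conj v))))
  distrib : ∀ v q a p → v *ᵍ (q +ᵍ negᵍ (a *ᵍ p)) ≡ (v *ᵍ q) +ᵍ negᵍ (a *ᵍ (v *ᵍ p))
  distrib = RingSolver.solve-∀ ℤ[i]-ring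

cf⇒zaremba : ∀ l {u m} → Unit u → den l ≡ u *ᵍ m →
             Open𝔉 (num l) (den l) → HCF (num l) (den l) l → AllNormLe18 l → Zaremba m
cf⇒zaremba l {u} {m} hu den≡um open𝔉 hcf bounded =
  a , cf-coprime l {u} (Unit⇒cancel-conj hu (num l)) (sym den≡um) ,
  subst (InF a) ū·den≡m (InF-unit-*ᵍ (Unit-conj hu) (Open⇒InF open𝔉)) ,
  l , subst (λ z → HCF a z l) ū·den≡m (HCF-unit-*ᵍ (Unit-conj hu) hcf) , bounded
  where
  a = conj u *ᵍ num l
  ū·den≡m : conj u *ᵍ den l ≡ m
  ū·den≡m = trans (cong (conj u *ᵍ_) den≡um) (Unit⇒conj-cancel hu m)

admissible⇒zaremba : ∀ {l m} → Admissible l → Associated (den l) m → Zaremba m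
admissible⇒zaremba {l} adm (u , hu , den≡um) =
  cf⇒zaremba l hu den≡um (proj₁ (admissible-value adm)) (admissible⇒HCF adm) (admissible⇒bounded adm)

AllShifts-conj : ∀ {P} → (∀ {d} → P d → P (conj d)) → ∀ {b} → AllShifts P b → AllShifts P (conj b)
AllShifts-conj {P} P-conj {b} (shifts p₁ p₂ p₃ p₄) =
  shifts (shift 1ᵍ p₁) (shift (negᵍ 1ᵍ) p₂) (shift (negᵍ ι) p₄) (shift ι p₃)
  where
  shift : ∀ δ → P (b +ᵍ δ) → P (conj b +ᵍ conj δ)
  shift δ p = subst P (conj-+ᵍ b δ) (P-conj p)

Free-conj : ∀ {b} → Free b → Free (conj b)
Free-conj = AllShifts-conj λ {d} far →
  subst₂ (λ a N → + ∣ re d ∣ + + a < N - + 1) (sym (ℤP.∣-i∣≡∣i∣ (im d))) (sym (norm-conj d)) far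

Guarded-conj : ∀ {b} → Guarded b → Guarded (conj b)
Guarded-conj = AllShifts-conj λ {d} → subst (+ 2 ≤_) (sym (norm-conj d))

Large-conj : ∀ {b} → Large b → Large (conj b)
Large-conj (inj₁ large-re) = inj₁ large-re
Large-conj (inj₂ (inj₁ 3≤im)) = inj₂ (inj₂ (ℤP.neg-mono-≤ 3≤im))
Large-conj (inj₂ (inj₂ im≤-3)) = inj₂ (inj₁ (ℤP.neg-mono-≤ im≤-3))

LeadsLarge-conj : ∀ {l} → LeadsLarge l → LeadsLarge (map conj l)
LeadsLarge-conj {[]} _ = _
LeadsLarge-conj {b ∷ l} = Large-conj

Admissible-conj : ∀ {l} → Admissible l → Admissible (map conj l)
Admissible-conj [] = []
Admissible-conj (free {b} fb n≤18 adm) =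
  free (Free-conj fb) (subst (_≤ + 18) (sym (norm-conj b)) n≤18) (Admissible-conj adm)
Admissible-conj (guarded {b} gb n≤18 leadsLarge adm) =
  guarded (Guarded-conj gb) (subst (_≤ + 18) (sym (norm-conj b)) n≤18) (LeadsLarge-conj leadsLarge) (Admissible-conj adm)

den-map-conj : ∀ l → den (map conj l) ≡ conj (den l)
num-map-conj : ∀ l → num (map conj l) ≡ conj (num l)

den-map-conj [] = refl
den-map-conj (a ∷ l) = begin
  (conj a *ᵍ den (map conj l)) +ᵍ num (map conj l)   ≡⟨ cong₂ (λ x y → (conj a *ᵍ x) +ᵍ y) (den-map-conj l) (num-map-conj l) ⟩
  (conj a *ᵍ conj (den l)) +ᵍ conj (num l)           ≡⟨ cong (_+ᵍ conj (num l)) (conj-*ᵍ a (den l)) ⟨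
  conj (a *ᵍ den l) +ᵍ conj (num l)                  ≡⟨ conj-+ᵍ (a *ᵍ den l) (num l) ⟨
  conj ((a *ᵍ den l) +ᵍ num l)                       ∎
  where open ≡-Reasoning

num-map-conj [] = refl
num-map-conj (a ∷ l) = den-map-conj l

Associated-conj : ∀ {x y} → Associated x y → Associated (conj x) (conj y)
Associated-conj {y = y} (u , hu , x≡uy) = conj u , Unit-conj hu , trans (cong conj x≡uy) (conj-*ᵍ u y)

ρ : ℤ[i]
ρ = base true

AdmissibleFor : ℕ → Set
AdmissibleFor k = Σ (List ℤ[i]) λ l → Admissible l × Associated (den l) (ρ ^ᵍ k)

AdmissibleFor⇒zaremba : ∀ sign k → AdmissibleFor k → Zaremba (base sign ^ᵍ k)
AdmissibleFor⇒zaremba true k (l , adm , den≈ρᵏ) = admissible⇒zaremba adm den≈ρᵏ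
AdmissibleFor⇒zaremba false k (l , adm , den≈ρᵏ) =
  admissible⇒zaremba (Admissible-conj adm)
    (subst₂ Associated (sym (den-map-conj l)) (conj-^ᵍ ρ k) (Associated-conj den≈ρᵏ))

allShifts? : ∀ {P} → (∀ d → Dec (P d)) → ∀ b → Dec (AllShifts P b)
allShifts? P? b =
  Dec.map′ (λ (p₁ , p₂ , p₃ , p₄) → shifts p₁ p₂ p₃ p₄) (λ (shifts p₁ p₂ p₃ p₄) → p₁ , p₂ , p₃ , p₄)
    (P? _ ×-dec P? _ ×-dec P? _ ×-dec P? _)

free? : ∀ b → Dec (Free b)
free? = allShifts? (λ d → _ ℤ.<? _)

guarded? : ∀ b → Dec (Guarded b)
guarded? = allShifts? (λ d → + 2 ℤ.≤? norm d)

large? : ∀ b → Dec (Large b)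
large? b = ((_ ℤ.≤? _) ⊎-dec (_ ℤ.≤? _)) ⊎-dec ((_ ℤ.≤? _) ⊎-dec (_ ℤ.≤? _))

leadsLarge? : ∀ l → Dec (LeadsLarge l)
leadsLarge? [] = yes _
leadsLarge? (b ∷ _) = large? b

checkAdmissible : ∀ l → Maybe (Admissible l)
checkAdmissible [] = just []
checkAdmissible (b ∷ l) with checkAdmissible l | norm b ℤ.≤? + 18 | free? b | guarded? b | leadsLarge? l
... | just adm | yes n≤18 | yes fb | _ | _ = just (free fb n≤18 adm)
... | just adm | yes n≤18 | no _ | yes gb | yes leadsLarge = just (guarded gb n≤18 leadsLarge adm)
... | _ | _ | _ | _ | _ = nothing

_≟ᵍ_ : (x y : ℤ[i]) → Dec (x ≡ y)
(a + b i) ≟ᵍ (c + d i) =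
  Dec.map′ (λ (a≡c , b≡d) → cong₂ _+_i a≡c b≡d) (λ eq → cong re eq , cong im eq) (a ℤ.≟ c ×-dec b ℤ.≟ d)

unit? : ∀ u → Dec (Unit u)
unit? u = Dec.map′ unit Unit.norm≡1 (norm u ℤ.≟ + 1)

associated? : ∀ x u y → Maybe (Associated x y)
associated? x u y with unit? u | x ≟ᵍ (u *ᵍ y)
... | yes hu | yes x≡uy = just (u , hu , x≡uy)
... | _ | _ = nothing

checkAdmissibleFor : ∀ k l u → Maybe (AdmissibleFor k)
checkAdmissibleFor k l u with checkAdmissible l | associated? (den l) u (ρ ^ᵍ k)
... | just adm | just den≈ρᵏ = just (l , adm , den≈ρᵏ)
... | _ | _ = nothing

open𝔉? : ∀ p q → Dec (Open𝔉 p q)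
open𝔉? p q =
  Dec.map′ (λ (n , a , b , c , d) → square n a b c d) (λ (square n a b c d) → n , a , b , c , d)
    ((_ ℤ.<? _) ×-dec (_ ℤ.<? _) ×-dec (_ ℤ.<? _) ×-dec (_ ℤ.<? _) ×-dec (_ ℤ.<? _))

isRound? : ∀ q p a → Dec (IsRound q p a)
isRound? q p a = ((_ ℤ.≤? _) ×-dec (_ ℤ.<? _)) ×-dec ((_ ℤ.≤? _) ×-dec (_ ℤ.<? _))

checkHCF : ∀ p q l → Maybe (HCF p q l)
checkHCF p q [] with p ≟ᵍ 0ᵍ
... | yes refl = just hcf-stop
... | no _ = nothing
checkHCF p q (a ∷ l) with p ≟ᵍ 0ᵍ | isRound? q p a | checkHCF (q -ᵍ (a *ᵍ p)) p l
... | no p≢0 | yes round | just rest = just (hcf-step p≢0 round rest)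
... | _ | _ | _ = nothing

checkBounded : ∀ l → Maybe (AllNormLe18 l)
checkBounded [] = just []
checkBounded (b ∷ l) with norm b ℤ.≤? + 18 | checkBounded l
... | yes n≤18 | just bounded = just (n≤18 ∷ bounded)
... | _ | _ = nothing

checkZaremba : ∀ l u m → Maybe (Zaremba m)
checkZaremba l u m with unit? u | den l ≟ᵍ (u *ᵍ m) | open𝔉? (num l) (den l) | checkHCF (num l) (den l) l | checkBounded l
... | yes hu | yes den≡um | yes open𝔉 | just hcf | just bounded = just (cf⇒zaremba l hu den≡um open𝔉 hcf bounded)
... | _ | _ | _ | _ | _ = nothing

-- Folding

mirror : List ℤ[i] → List ℤ[i]
mirror l = reverse (map negᵍ l)

mirror-++ : ∀ xs ys → mirror (xs ++ ys) ≡ mirror ys ++ mirror xs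
mirror-++ xs ys = trans (cong reverse (map-++ negᵍ xs ys)) (reverse-++ (map negᵍ xs) (map negᵍ ys))

mirror-involutive : ∀ l → mirror (mirror l) ≡ l
mirror-involutive l = begin
  reverse (map negᵍ (reverse (map negᵍ l)))   ≡⟨ cong reverse (reverse-map negᵍ (map negᵍ l)) ⟩
  reverse (reverse (map negᵍ (map negᵍ l)))   ≡⟨ reverse-involutive (map negᵍ (map negᵍ l)) ⟩
  map negᵍ (map negᵍ l)                       ≡⟨ map-∘ l ⟨
  map (λ x → negᵍ (negᵍ x)) l                 ≡⟨ map-cong negᵍ-involutive l ⟩
  map id l                                    ≡⟨ map-id l ⟩
  l                                           ∎
  where open ≡-Reasoning

cfMatrix-mirror : ∀ l → cfMatrix (mirror l) ≡ scale (negᵍ 1ᵍ ^ᵍ length l) (flip (cfMatrix l))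
cfMatrix-mirror [] = refl
cfMatrix-mirror (a ∷ l) = begin
  cfMatrix (mirror (a ∷ l))                             ≡⟨ cong cfMatrix (mirror-++ (a ∷ []) l) ⟩
  cfMatrix (mirror l ++ negᵍ a ∷ [])                    ≡⟨ cfMatrix-++ (mirror l) (negᵍ a ∷ []) ⟩
  cfMatrix (mirror l) · M                               ≡⟨ cong (_· M) (cfMatrix-mirror l) ⟩
  scale σ (flip P) · M                                  ≡⟨ scale-·ˡ σ (flip P) M ⟩
  scale σ (flip P · M)                                  ≡⟨ cong (λ c → scale c (flip P · M)) (sign-twice σ) ⟩
  scale ((negᵍ 1ᵍ *ᵍ σ) *ᵍ negᵍ 1ᵍ) (flip P · M)        ≡⟨ scale-scale (negᵍ 1ᵍ *ᵍ σ) (negᵍ 1ᵍ) (flip P · M) ⟨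
  scale (negᵍ 1ᵍ *ᵍ σ) (scale (negᵍ 1ᵍ) (flip P · M))   ≡⟨ cong (scale (negᵍ 1ᵍ *ᵍ σ)) (flip-push a P) ⟨
  scale (negᵍ 1ᵍ *ᵍ σ) (flip (push a P))                ∎
  where
  open ≡-Reasoning
  P = cfMatrix l
  M = cfMatrix (negᵍ a ∷ [])
  σ = negᵍ 1ᵍ ^ᵍ length l
  sign-twice : ∀ σ → σ ≡ (negᵍ 1ᵍ *ᵍ σ) *ᵍ negᵍ 1ᵍ
  sign-twice = RingSolver.solve-∀ ℤ[i]-ring

m₁₁-fold : ∀ σ x X → m₁₁ (X · push x (scale σ (flip X))) ≡ ((σ *ᵍ x) *ᵍ m₁₁ X) *ᵍ m₁₁ X
m₁₁-fold σ x (mat p q r s) = expand σ x p q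
  where
  expand : ∀ σ x p q → (p *ᵍ ((x *ᵍ (σ *ᵍ p)) +ᵍ (σ *ᵍ negᵍ q))) +ᵍ (q *ᵍ (σ *ᵍ p)) ≡ ((σ *ᵍ x) *ᵍ p) *ᵍ p
  expand = RingSolver.solve-∀ ℤ[i]-ring

den-fold : ∀ l x → den (l ++ x ∷ mirror l) ≡ (((negᵍ 1ᵍ ^ᵍ length l) *ᵍ x) *ᵍ den l) *ᵍ den l
den-fold l x = begin
  m₁₁ (cfMatrix (l ++ x ∷ mirror l))             ≡⟨ cong m₁₁ (cfMatrix-++ l (x ∷ mirror l)) ⟩
  m₁₁ (P · push x (cfMatrix (mirror l)))         ≡⟨ cong (λ Q → m₁₁ (P · push x Q)) (cfMatrix-mirror l) ⟩
  m₁₁ (P · push x (scale σ (flip P)))            ≡⟨ m₁₁-fold σ x P ⟩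
  ((σ *ᵍ x) *ᵍ den l) *ᵍ den l                   ∎
  where
  open ≡-Reasoning
  P = cfMatrix l
  σ = negᵍ 1ᵍ ^ᵍ length l

den-infix-scale : ∀ xs {us vs} ys {c} → cfMatrix us ≡ scale c (cfMatrix vs) →
                  den (xs ++ us ++ ys) ≡ c *ᵍ den (xs ++ vs ++ ys)
den-infix-scale xs {us} {vs} ys {c} us≡c·vs = cong m₁₁ (begin
  cfMatrix (xs ++ us ++ ys)                 ≡⟨ cfMatrix-++ xs (us ++ ys) ⟩
  X · cfMatrix (us ++ ys)                   ≡⟨ cong (X ·_) (cfMatrix-++ us ys) ⟩
  X · (cfMatrix us · Y)                     ≡⟨ cong (λ U → X · (U · Y)) us≡c·vs ⟩
  X · (scale c (cfMatrix vs) · Y)           ≡⟨ cong (X ·_) (scale-·ˡ c (cfMatrix vs) Y) ⟩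
  X · scale c (cfMatrix vs · Y)             ≡⟨ scale-·ʳ c X (cfMatrix vs · Y) ⟩
  scale c (X · (cfMatrix vs · Y))           ≡⟨ cong (λ Z → scale c (X · Z)) (cfMatrix-++ vs ys) ⟨
  scale c (X · cfMatrix (vs ++ ys))         ≡⟨ cong (scale c) (cfMatrix-++ xs (vs ++ ys)) ⟨
  scale c (cfMatrix (xs ++ vs ++ ys))       ∎)
  where
  open ≡-Reasoning
  X = cfMatrix xs
  Y = cfMatrix ys

ε : ℤ[i]
ε = (+ 3) + (+ 2) i

framed : List ℤ[i] → List ℤ[i]
framed w = negᵍ ε ∷ w ++ ε ∷ []

spliceMirror : List ℤ[i] → List ℤ[i] → List ℤ[i]
spliceMirror w us = w ++ us ++ mirror w

mirror-framed : ∀ w → mirror (framed w) ≡ framed (mirror w)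
mirror-framed w = trans (mirror-++ (negᵍ ε ∷ []) (w ++ ε ∷ [])) (cong (_++ ε ∷ []) (mirror-++ w (ε ∷ [])))

mirror-spliceMirror : ∀ w us → mirror (spliceMirror w us) ≡ spliceMirror w (mirror us)
mirror-spliceMirror w us = begin
  mirror (w ++ us ++ mirror w)             ≡⟨ mirror-++ w (us ++ mirror w) ⟩
  mirror (us ++ mirror w) ++ mirror w      ≡⟨ cong (_++ mirror w) (mirror-++ us (mirror w)) ⟩
  (mirror (mirror w) ++ mirror us) ++ mirror w   ≡⟨ cong (λ v → (v ++ mirror us) ++ mirror w) (mirror-involutive w) ⟩
  (w ++ mirror us) ++ mirror w             ≡⟨ ++-assoc w (mirror us) (mirror w) ⟩
  w ++ mirror us ++ mirror w               ∎
  where open ≡-Reasoning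

framed-spliceMirror : ∀ w us → framed (spliceMirror w us) ≡ (negᵍ ε ∷ w) ++ us ++ mirror w ++ ε ∷ []
framed-spliceMirror w us =
  cong (negᵍ ε ∷_) (trans (++-assoc w (us ++ mirror w) (ε ∷ [])) (cong (w ++_) (++-assoc us (mirror w) (ε ∷ []))))

den-framed-fold : ∀ w x → den (framed (spliceMirror w (ε ∷ x ∷ negᵍ ε ∷ []))) ≡
                  (((negᵍ 1ᵍ ^ᵍ length (framed w)) *ᵍ x) *ᵍ den (framed w)) *ᵍ den (framed w)
den-framed-fold w x = trans (cong den framed-fold) (den-fold (framed w) x)
  where
  framed-fold : framed (spliceMirror w (ε ∷ x ∷ negᵍ ε ∷ [])) ≡ framed w ++ x ∷ mirror (framed w)
  framed-fold = trans (framed-spliceMirror w _)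
    (trans (sym (++-assoc (negᵍ ε ∷ w) (ε ∷ []) (x ∷ framed (mirror w))))
      (cong (λ v → framed w ++ x ∷ v) (sym (mirror-framed w))))

g₁ g₂ : ℤ[i]
g₁ = (+ 3) + (+ 1) i
g₂ = (- + 3) + (- + 3) i

cfMatrix-g₁g₂ : cfMatrix (g₁ ∷ g₂ ∷ []) ≡ scale (negᵍ ι) (cfMatrix (ε ∷ ι ∷ negᵍ ε ∷ []))
cfMatrix-g₁g₂ = refl

den-framed-pair : ∀ w → den (framed (spliceMirror w (g₁ ∷ g₂ ∷ []))) ≡ negᵍ ι *ᵍ den (framed (spliceMirror w (ε ∷ ι ∷ negᵍ ε ∷ [])))
den-framed-pair w = begin
  den (framed (spliceMirror w (g₁ ∷ g₂ ∷ [])))                 ≡⟨ cong den (framed-spliceMirror w _) ⟩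
  den ((negᵍ ε ∷ w) ++ (g₁ ∷ g₂ ∷ []) ++ tail)                 ≡⟨ den-infix-scale (negᵍ ε ∷ w) {g₁ ∷ g₂ ∷ []} {ε ∷ ι ∷ negᵍ ε ∷ []} tail {negᵍ ι} cfMatrix-g₁g₂ ⟩
  negᵍ ι *ᵍ den ((negᵍ ε ∷ w) ++ (ε ∷ ι ∷ negᵍ ε ∷ []) ++ tail) ≡⟨ cong (λ v → negᵍ ι *ᵍ den v) (framed-spliceMirror w _) ⟨
  negᵍ ι *ᵍ den (framed (spliceMirror w (ε ∷ ι ∷ negᵍ ε ∷ []))) ∎
  where
  open ≡-Reasoning
  tail = mirror w ++ ε ∷ []

-- Gluing at a large digit keeps the guard of the preceding digit satisfied.
Admissible-glue : ∀ xs {c c′ ys} → Admissible (xs ++ c ∷ []) → Large c′ → Admissible (c′ ∷ ys) → Admissible (xs ++ c′ ∷ ys)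
Admissible-glue [] _ _ adm′ = adm′
Admissible-glue (a ∷ xs) (free fa n≤18 adm) large adm′ = free fa n≤18 (Admissible-glue xs adm large adm′)
Admissible-glue (a ∷ []) (guarded ga n≤18 _ adm) large adm′ = guarded ga n≤18 large adm′
Admissible-glue (a ∷ x ∷ xs) (guarded ga n≤18 leadsLarge adm) large adm′ =
  guarded ga n≤18 leadsLarge (Admissible-glue (x ∷ xs) adm large adm′)

Admissible-fold : ∀ {w x} → Admissible (framed w) → Admissible (framed (mirror w)) → Guarded x → norm x ≤ + 18 →
                  Admissible (framed (spliceMirror w (ε ∷ x ∷ negᵍ ε ∷ [])))
Admissible-fold {w} adm adm′ gx nx = subst Admissible (sym (framed-spliceMirror w _))
  (Admissible-glue (negᵍ ε ∷ w) adm (from-yes (large? ε))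
    (free (from-yes (free? ε)) (from-yes (norm ε ℤ.≤? + 18)) (guarded gx nx (from-yes (large? (negᵍ ε))) adm′)))

Admissible-pair : ∀ {w a b} → Free a → Large a → norm a ≤ + 18 → Free b → norm b ≤ + 18 →
                  Admissible (framed w) → Admissible (framed (mirror w)) → Admissible (framed (spliceMirror w (a ∷ b ∷ [])))
Admissible-pair {w} fa la na fb nb adm adm′ = subst Admissible (sym (framed-spliceMirror w _))
  (Admissible-glue (negᵍ ε ∷ w) adm la (free fa na (free fb nb (Admissible-tail adm′))))

fold-associated : ∀ {σ d r} c x → Unit σ → Associated d r →
                  Associated (c *ᵍ (((σ *ᵍ x) *ᵍ d) *ᵍ d)) ((c *ᵍ x) *ᵍ (r *ᵍ r))
fold-associated {σ} {r = r} c x hσ (u , hu , refl) = (σ *ᵍ u) *ᵍ u , Unit-*ᵍ (Unit-*ᵍ hσ hu) hu , regroup c σ x u r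
  where
  regroup : ∀ c σ x u r → c *ᵍ (((σ *ᵍ x) *ᵍ (u *ᵍ r)) *ᵍ (u *ᵍ r)) ≡ ((σ *ᵍ u) *ᵍ u) *ᵍ ((c *ᵍ x) *ᵍ (r *ᵍ r))
  regroup = RingSolver.solve-∀ ℤ[i]-ring

^ᵍ-+ : ∀ z m n → z ^ᵍ (m ℕ.+ n) ≡ (z ^ᵍ m) *ᵍ (z ^ᵍ n)
^ᵍ-+ z zero n = sym (*ᵍ-identityˡ (z ^ᵍ n))
^ᵍ-+ z (suc m) n = trans (cong (z *ᵍ_) (^ᵍ-+ z m n)) (sym (*ᵍ-assoc z (z ^ᵍ m) (z ^ᵍ n)))

record Foldable (k : ℕ) (w : List ℤ[i]) : Set where
  field
    admissible : Admissible (framed w)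
    admissible-mirror : Admissible (framed (mirror w))
    den-associated : Associated (den (framed w)) (ρ ^ᵍ k)
open Foldable

Foldable⇒AdmissibleFor : ∀ {k w} → Foldable k w → AdmissibleFor k
Foldable⇒AdmissibleFor {w = w} F = framed w , admissible F , den-associated F

Foldable-odd : ∀ {k w} → Foldable k w → Foldable (suc (k ℕ.+ k)) (spliceMirror w (ε ∷ ρ ∷ negᵍ ε ∷ []))
Foldable-odd {k} {w} F = record
  { admissible = Admissible-fold (admissible F) (admissible-mirror F) (from-yes (guarded? ρ)) (from-yes (norm ρ ℤ.≤? + 18))
  ; admissible-mirror = subst (λ v → Admissible (framed v)) (sym (mirror-spliceMirror w _))
      (Admissible-fold (admissible F) (admissible-mirror F) (from-yes (guarded? (negᵍ ρ))) (from-yes (norm (negᵍ ρ) ℤ.≤? + 18)))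
  ; den-associated = subst₂ Associated
      (trans (*ᵍ-identityˡ _) (sym (den-framed-fold w ρ))) (cong (ρ *ᵍ_) (sym (^ᵍ-+ ρ k k)))
      (fold-associated 1ᵍ ρ (Unit-^ᵍ {negᵍ 1ᵍ} (length (framed w)) (unit refl)) (den-associated F))
  }

Foldable-even : ∀ {k w} → Foldable k w → Foldable (k ℕ.+ k) (spliceMirror w (g₁ ∷ g₂ ∷ []))
Foldable-even {k} {w} F = record
  { admissible = Admissible-pair (from-yes (free? g₁)) (from-yes (large? g₁)) (from-yes (norm g₁ ℤ.≤? + 18))
      (from-yes (free? g₂)) (from-yes (norm g₂ ℤ.≤? + 18)) (admissible F) (admissible-mirror F)
  ; admissible-mirror = subst (λ v → Admissible (framed v)) (sym (mirror-spliceMirror w _))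
      (Admissible-pair (from-yes (free? (negᵍ g₂))) (from-yes (large? (negᵍ g₂))) (from-yes (norm (negᵍ g₂) ℤ.≤? + 18))
        (from-yes (free? (negᵍ g₁))) (from-yes (norm (negᵍ g₁) ℤ.≤? + 18)) (admissible F) (admissible-mirror F))
  ; den-associated = subst₂ Associated
      (trans (cong (negᵍ ι *ᵍ_) (sym (den-framed-fold w ι))) (sym (den-framed-pair w)))
      (trans (*ᵍ-identityˡ _) (sym (^ᵍ-+ ρ k k)))
      (fold-associated (negᵍ ι) ι (Unit-^ᵍ {negᵍ 1ᵍ} (length (framed w)) (unit refl)) (den-associated F))
  }

checkFoldable : ∀ k w u → Maybe (Foldable k w)
checkFoldable k w u with checkAdmissible (framed w) | checkAdmissible (framed (mirror w)) | associated? (den (framed w)) u (ρ ^ᵍ k)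
... | just adm | just adm′ | just den≈ρᵏ = just record { admissible = adm ; admissible-mirror = adm′ ; den-associated = den≈ρᵏ }
... | _ | _ | _ = nothing

data Parity : ℕ → Set where
  even : ∀ h → Parity (h ℕ.+ h)
  odd : ∀ h → Parity (suc (h ℕ.+ h))

parity : ∀ n → Parity n
parity zero = even zero
parity (suc n) with parity n
... | even h = odd h
... | odd h = subst Parity (cong suc (ℕP.+-suc h h)) (even (suc h))

7+h+7+h : ∀ h → (7 ℕ.+ h) ℕ.+ (7 ℕ.+ h) ≡ 14 ℕ.+ (h ℕ.+ h)
7+h+7+h = ℕ-solve-∀

Foldable-double : ∀ h → ∃ (Foldable (7 ℕ.+ h)) → ∃ (Foldable (14 ℕ.+ (h ℕ.+ h)))
Foldable-double h (w , F) = spliceMirror w (g₁ ∷ g₂ ∷ []) ,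
  subst (λ k → Foldable k (spliceMirror w (g₁ ∷ g₂ ∷ []))) (7+h+7+h h) (Foldable-even F)

Foldable-double+1 : ∀ h → ∃ (Foldable (7 ℕ.+ h)) → ∃ (Foldable (15 ℕ.+ (h ℕ.+ h)))
Foldable-double+1 h (w , F) = spliceMirror w (ε ∷ ρ ∷ negᵍ ε ∷ []) ,
  subst (λ k → Foldable k (spliceMirror w (ε ∷ ρ ∷ negᵍ ε ∷ []))) (cong suc (7+h+7+h h)) (Foldable-odd F)

foldable : ∀ n → ∃ (Foldable (6 ℕ.+ n))
foldable = <-rec (λ n → ∃ (Foldable (6 ℕ.+ n))) step
  where
  half-< : ∀ h j → suc h ℕ.< j ℕ.+ suc (suc (h ℕ.+ h))
  half-< h j = ℕP.≤-trans (ℕ.s≤s (ℕ.s≤s (ℕP.m≤m+n h h))) (ℕP.m≤n+m _ j)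

  step : ∀ n → (∀ {m} → m ℕ.< n → ∃ (Foldable (6 ℕ.+ m))) → ∃ (Foldable (6 ℕ.+ n))
  step 0 _ = _ , from-just (checkFoldable 6 (((- + 1) + (- + 4) i) ∷ ((+ 1) + (+ 2) i) ∷ []) 1ᵍ)
  step 1 _ = _ , from-just (checkFoldable 7 (((- + 1) + (- + 3) i) ∷ ((- + 2) + (+ 1) i) ∷ ((+ 1) + (+ 3) i) ∷ []) 1ᵍ)
  step 2 _ = _ , from-just (checkFoldable 8 (((- + 2) + (+ 3) i) ∷ ((+ 0) + (+ 4) i) ∷ ((+ 2) + (- + 2) i) ∷ []) (negᵍ ι))
  step 3 _ = _ , from-just (checkFoldable 9 (((+ 2) + (- + 1) i) ∷ ((+ 1) + (+ 3) i) ∷ ((- + 2) + (+ 1) i) ∷ ((- + 1) + (- + 3) i) ∷ ((- + 2) + (+ 1) i) ∷ []) (negᵍ 1ᵍ))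
  step 4 _ = _ , from-just (checkFoldable 10 (((+ 2) + (- + 1) i) ∷ ((- + 3) + (+ 0) i) ∷ ((- + 3) + (- + 2) i) ∷ ((- + 1) + (- + 4) i) ∷ ((+ 2) + (+ 2) i) ∷ []) ι)
  step 5 _ = _ , from-just (checkFoldable 11 (((+ 4) + (+ 1) i) ∷ ((+ 0) + (+ 4) i) ∷ ((- + 2) + (+ 1) i) ∷ ((+ 0) + (- + 4) i) ∷ ((- + 4) + (- + 1) i) ∷ []) 1ᵍ)
  step 6 _ = _ , from-just (checkFoldable 12 (((- + 2) + (- + 3) i) ∷ ((+ 0) + (- + 3) i) ∷ ((- + 3) + (- + 3) i) ∷ ((+ 3) + (+ 1) i) ∷ ((+ 0) + (+ 3) i) ∷ ((+ 2) + (+ 3) i) ∷ []) 1ᵍ)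
  step 7 _ = _ , from-just (checkFoldable 13 (((- + 2) + (+ 1) i) ∷ ((+ 2) + (- + 3) i) ∷ ((- + 1) + (- + 4) i) ∷ ((- + 2) + (+ 1) i) ∷ ((+ 1) + (+ 4) i) ∷ ((- + 2) + (+ 3) i) ∷ ((+ 2) + (- + 1) i) ∷ []) 1ᵍ)
  step (suc (suc (suc (suc (suc (suc (suc (suc n)))))))) rec with parity n
  ... | even h = Foldable-double h (rec (half-< h 6))
  ... | odd h = Foldable-double+1 h (rec (half-< h 7))

admissibleFor₁ : AdmissibleFor 1
admissibleFor₁ = from-just (checkAdmissibleFor 1 (ρ ∷ []) 1ᵍ)

admissibleFor₃ : AdmissibleFor 3
admissibleFor₃ = from-just (checkAdmissibleFor 3 (((- + 1) + (- + 3) i) ∷ ((- + 3) + (- + 2) i) ∷ []) 1ᵍ)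

admissibleFor₄ : AdmissibleFor 4
admissibleFor₄ = from-just (checkAdmissibleFor 4 (((+ 1) + (+ 2) i) ∷ ((- + 4) + (+ 1) i) ∷ ((+ 3) + (+ 1) i) ∷ []) 1ᵍ)

admissibleFor₅ : AdmissibleFor 5
admissibleFor₅ = from-just (checkAdmissibleFor 5 (((- + 1) + (- + 4) i) ∷ ((- + 1) + (+ 3) i) ∷ ((+ 3) + (+ 3) i) ∷ []) 1ᵍ)

-- These expansions are not admissible (-1 ± i is not guarded), so they are checked directly.
zaremba₂ : ∀ sign → Zaremba (base sign ^ᵍ 2)
zaremba₂ true = from-just (checkZaremba (((- + 1) + (+ 1) i) ∷ ((+ 0) + (- + 3) i) ∷ []) ι (base true ^ᵍ 2))
zaremba₂ false = from-just (checkZaremba (((- + 1) + (- + 1) i) ∷ ((+ 0) + (+ 3) i) ∷ []) (negᵍ ι) (base false ^ᵍ 2))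

theorem5p2 : (sign : Bool) (k : ℕ) → k ≥ 1 →
    Σ ℤ[i] λ a → Coprimeᵍ a (base sign ^ᵍ k) × InF a (base sign ^ᵍ k) ×
    Σ (List ℤ[i]) λ ds → HCF a (base sign ^ᵍ k) ds × AllNormLe18 ds
theorem5p2 sign zero ()
theorem5p2 sign 1 _ = AdmissibleFor⇒zaremba sign 1 admissibleFor₁
theorem5p2 sign 2 _ = zaremba₂ sign
theorem5p2 sign 3 _ = AdmissibleFor⇒zaremba sign 3 admissibleFor₃
theorem5p2 sign 4 _ = AdmissibleFor⇒zaremba sign 4 admissibleFor₄
theorem5p2 sign 5 _ = AdmissibleFor⇒zaremba sign 5 admissibleFor₅
theorem5p2 sign (suc (suc (suc (suc (suc (suc n)))))) _ =
  AdmissibleFor⇒zaremba sign (6 ℕ.+ n) (Foldable⇒AdmissibleFor (proj₂ (foldable n)))
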